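{- If $d$ is a tree degree sequence with $n(d)\geq 3$, then $$\max\{\nu(T): T \text{ a tree with } d(T)=d\}=\min\left\{ \left\lfloor \frac{n(d)}{2}\right\rfloor,\, n(d)-n_1(d)\right\}.$$
   Context: All graphs are finite, simple and undirected. For a graph $G$, $\nu(G)$ denotes its matching number. The degree sequence $d(G)$ of a graph $G$ is the nonincreasing sequence of the degrees of its vertices. A tree degree sequence is the degree sequence of some tree. For a finite sequence $d$, $n(d)$ is the number of its entries and $n_1(d)$ is the number of its entries equal to $1$. -}

module Defs where

open import Data.Nat using (ℕ; zero; suc; _≤_; _≥_; _⊓_; _∸_; _/_; _≡ᵇ_)
open import Data.Bool using (Bool; true; false)
open import Data.Fin using (Fin)
open import Data.List using (List; []; _∷_; length; map; filterᵇ; allFin; concatMap; head; last)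
open import Data.List.Relation.Unary.Unique.Propositional using (Unique)
import Data.List.Membership.Propositional
open import Data.List.Relation.Unary.Linked using (Linked)
open import Data.List.Relation.Binary.Permutation.Propositional using (_↭_)
open import Data.Product using (Σ; ∃; _×_; _,_)
open import Data.Maybe using (Maybe; just; nothing)
open import Relation.Binary.PropositionalEquality using (_≡_)
open import Relation.Nullary using (¬_)

record Graph (n : ℕ) : Set where
  field
    adj   : Fin n → Fin n → Bool
    irrefl : ∀ i → adj i i ≡ false
    sym   : ∀ i j → adj i j ≡ adj j i
open Graph public

module _ {n : ℕ} (G : Graph n) where

  Adj : Fin n → Fin n → Set
  Adj i j = adj G i j ≡ true

  deg : Fin n → ℕ
  deg i = length (filterᵇ (adj G i) (allFin n))

  data Reach : Fin n → Fin n → Set where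
    here : ∀ {i} → Reach i i
    step : ∀ {i k j} → Adj i k → Reach k j → Reach i j

  Connected : Set
  Connected = ∀ i j → Reach i j

  IsCycle : List (Fin n) → Set
  IsCycle vs = 3 ≤ length vs × Unique vs × Linked Adj vs ×
               (∀ a b → head vs ≡ just a → last vs ≡ just b → Adj b a)

  Acyclic : Set
  Acyclic = ∀ vs → ¬ IsCycle vs

  IsTree : Set
  IsTree = 1 ≤ n × Connected × Acyclic

  IsMatching : List (Fin n × Fin n) → Set
  IsMatching M = (∀ {e} → e Data.List.Membership.Propositional.∈ M → Adjₚ e)
               × Unique (concatMap (λ { (a , b) → a ∷ b ∷ [] }) M)
    where
      Adjₚ : Fin n × Fin n → Set
      Adjₚ (a , b) = Adj a b

  MatchingNumber : ℕ → Set
  MatchingNumber k = (∃ λ M → IsMatching M × length M ≡ k)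
                   × (∀ M → IsMatching M → length M ≤ k)

  DegSeq : List ℕ → Set
  DegSeq d = Linked _≥_ d × d ↭ map deg (allFin n)

TreeDegSeq : List ℕ → Set
TreeDegSeq d = Σ ℕ λ n → Σ (Graph n) λ T → IsTree T × DegSeq T d

nOf : List ℕ → ℕ
nOf = length

n₁ : List ℕ → ℕ
n₁ d = length (filterᵇ (_≡ᵇ 1) d)

-- A matching has distinct ends, so 2ν ≤ n. For n ≥ 3 no edge of a tree joins two leaves, so picking a
-- non-leaf end of every matching edge is injective, and ν ≤ n − n₁.
-- Conversely, let A be the non-leaf degrees (k = |A|, all ≥ 2) and L = n₁, so that ∑A + 2 = 2k + L by
-- the degree sum of trees. A tree with these degrees and a matching of at least min(k, ⌊n/2⌋) edges is
-- obtained by induction on n, grafting onto a smaller such tree: a matched pendant edge when A has an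
-- entry ≥ 3 and a 2; a single leaf when all of A is ≥ 3, for then L ≥ k + 2 and k ≤ ⌊(n − 1)/2⌋
-- already; two more vertices at an end when the tree is a path. A suffix of that matching has exactly
-- min(k, ⌊n/2⌋) edges.

module Submission where

open import Defs hiding (sym)
open import Data.Bool using (Bool; true; false; not; if_then_else_; T?)
open import Data.Unit using (tt)
open import Data.Empty using (⊥)
open import Data.Nat using (ℕ; zero; suc; _+_; _*_; _≤_; _<_; _⊓_; _∸_; _/_; _≡ᵇ_; z≤n; s≤s; s≤s⁻¹; _≤?_)
  renaming (_≟_ to _≟ℕ_)
open import Data.Nat.Properties
  using (+-0-commutativeMonoid; +-suc; +-comm; +-identityʳ; *-suc; *-comm; *-zeroʳ; *-distribˡ-+; suc-injective;
         +-cancelˡ-≡; +-cancelʳ-≡; +-cancelˡ-≤; *-cancelˡ-≤; +-mono-≤; +-monoˡ-≤; +-monoʳ-≤;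
         ≤-refl; ≤-reflexive; ≤-trans; ≤-antisym; ≤∧≢⇒<; ≰⇒>; <⇒≱; m≤m+n; m≤n+m;
         m+n∸n≡m; m∸[m∸n]≡n; m⊓n≤m; m⊓n≤n; ⊓-glb; ≡ᵇ⇒≡; module ≤-Reasoning)
open import Data.Nat.DivMod using (m*n/n≡m; /-monoˡ-≤; m<n*o⇒m/o<n)
open import Data.Nat.ListAction using (sum)
open import Data.Nat.ListAction.Properties using (sum-↭; sum-++)
open import Data.Nat.Tactic.RingSolver using (solve-∀)
open import Data.Fin using (Fin; zero; suc; punchIn; punchOut)
import Data.Fin as Fin
open import Data.Fin.Properties using (_≟_; punchInᵢ≢i; punchIn-punchOut; punchIn-injective)
open import Data.List
  using (List; []; _∷_; [_]; _++_; length; map; concatMap; tabulate; filterᵇ; allFin; replicate; drop; last)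
open import Data.List.Properties
  using (length-++; length-map; length-drop; length-tabulate; length-replicate; last-map; ++-assoc;
         tabulate-cong; map-tabulate)
open import Data.List.Membership.Propositional using (_∈_; _∉_; find)
open import Data.List.Membership.Propositional.Properties using (∈-∃++; ∈-allFin; ∈-filter⁺; ∈-map⁻; ∈-tabulate⁻)
open import Data.List.Relation.Unary.Any using (Any; here; there; any?)
open import Data.List.Relation.Unary.All using (All; []; _∷_; lookup)
import Data.List.Relation.Unary.All as All
import Data.List.Relation.Unary.All.Properties as All
open import Data.List.Relation.Unary.All.Properties using (¬Any⇒All¬)
open import Data.List.Relation.Unary.AllPairs using ([]; _∷_)
open import Data.List.Relation.Unary.Linked using (Linked; []; [-]; _∷_)
import Data.List.Relation.Unary.Linked as Linked
import Data.List.Relation.Unary.Linked.Properties as Linked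
open import Data.List.Relation.Unary.Unique.Propositional using (Unique)
import Data.List.Relation.Unary.Unique.Propositional.Properties as Unique
open import Data.List.Relation.Binary.Subset.Propositional using (_⊆_)
open import Data.List.Relation.Binary.Permutation.Propositional
  using (_↭_; ↭-refl; ↭-sym; ↭-trans; ↭-reflexive; prep; swap; module PermutationReasoning)
open import Data.List.Relation.Binary.Permutation.Propositional.Properties
  using (shift; drop-∷; ↭-length; ++⁺ʳ; All-resp-↭; ∈-resp-↭; filter-↭)
open import Data.Maybe using (just)
open import Data.Maybe.Properties using (just-injective)
import Data.Maybe.Relation.Binary.Connected as Maybe
open import Data.Product using (Σ; ∃; _×_; _,_; proj₁; proj₂)
import Data.Product as Product
open import Data.Sum using (_⊎_; inj₁; inj₂)
open import Function using (_∘_; id; case_of_)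
open import Relation.Binary.PropositionalEquality
  using (_≡_; _≢_; refl; sym; trans; cong; cong₂; subst; subst₂; module ≡-Reasoning)
open import Relation.Nullary using (¬_; does; yes; no; contradiction)
open import Relation.Nullary.Decidable using (dec-true; dec-false)
open import Algebra.Properties.CommutativeMonoid.Sum +-0-commutativeMonoid
  using (sum-remove; sum-replicate-zero; sum-cong-≗; ∑-distrib-+) renaming (sum to ∑)

indicator : Bool → ℕ
indicator true = 1
indicator false = 0

count : ∀ {n} → (Fin n → Bool) → ℕ
count p = ∑ (indicator ∘ p)

length-filterᵇ-tabulate : ∀ {A : Set} {n} (p : A → Bool) (f : Fin n → A) →
  length (filterᵇ p (tabulate f)) ≡ count (p ∘ f)
length-filterᵇ-tabulate {n = zero} p f = refl
length-filterᵇ-tabulate {n = suc n} p f with p (f zero)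
... | true = cong suc (length-filterᵇ-tabulate p (f ∘ suc))
... | false = length-filterᵇ-tabulate p (f ∘ suc)

sum-tabulate : ∀ {n} (f : Fin n → ℕ) → sum (tabulate f) ≡ ∑ f
sum-tabulate {zero} f = refl
sum-tabulate {suc n} f = cong (f zero +_) (sum-tabulate (f ∘ suc))

count-remove : ∀ {n} (p : Fin (suc n) → Bool) i → count p ≡ indicator (p i) + count (p ∘ punchIn i)
count-remove p i = sum-remove {i = i} (indicator ∘ p)

count-false : ∀ {n} → count {n} (λ _ → false) ≡ 0
count-false {n} = sum-replicate-zero n

count-cong : ∀ {n} {p q : Fin n → Bool} → (∀ i → p i ≡ q i) → count p ≡ count q
count-cong e = sum-cong-≗ (cong indicator ∘ e)

count-point : ∀ {n} (i : Fin n) → count (λ j → does (j ≟ i)) ≡ 1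
count-point {suc n} i = trans (count-remove (λ j → does (j ≟ i)) i)
  (cong₂ _+_ (cong indicator (dec-true (i ≟ i) refl))
             (trans (count-cong (λ j → dec-false (punchIn i j ≟ i) (punchInᵢ≢i i j))) (count-false {n})))

count-positive : ∀ {n} (p : Fin n → Bool) {i} → p i ≡ true → 1 ≤ count p
count-positive {suc n} p {i} pi rewrite count-remove p i | pi = s≤s z≤n

count-witness : ∀ {n} (p : Fin n → Bool) → 1 ≤ count p → ∃ λ i → p i ≡ true
count-witness {suc n} p c with p zero in p0
... | true = zero , p0
... | false with i , pi ← count-witness (p ∘ suc) c = suc i , pi

count≡1⇒unique : ∀ {n} (p : Fin n → Bool) → count p ≡ 1 → ∀ {y z} → p y ≡ true → p z ≡ true → y ≡ z
count≡1⇒unique {suc n} p c {y} {z} py pz with y ≟ z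
... | yes y≡z = y≡z
... | no y≢z rewrite count-remove p y | py
  with () ← subst (1 ≤_) (suc-injective c)
                  (count-positive (p ∘ punchIn y) (trans (cong p (punchIn-punchOut y≢z)) pz))

count≥2⇒another : ∀ {n} (p : Fin n → Bool) → 2 ≤ count p →
                   ∀ {y} → p y ≡ true → ∃ λ z → z ≢ y × p z ≡ true
count≥2⇒another {suc n} p c {y} py rewrite count-remove p y | py
  with z , pz ← count-witness (p ∘ punchIn y) (s≤s⁻¹ c) = punchIn y z , punchInᵢ≢i y z , pz

count-not : ∀ {n} (p : Fin n → Bool) → count (not ∘ p) + count p ≡ n
count-not {zero} p = refl
count-not {suc n} p with p zero
... | true = trans (+-suc _ _) (cong suc (count-not (p ∘ suc)))
... | false = cong suc (count-not (p ∘ suc))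

∈-remove : ∀ {A : Set} {x y : A} pre post → y ∈ pre ++ x ∷ post → y ≢ x → y ∈ pre ++ post
∈-remove [] post (here y≡x) y≢x = contradiction y≡x y≢x
∈-remove [] post (there y∈) y≢x = y∈
∈-remove (p ∷ pre) post (here y≡p) y≢x = here y≡p
∈-remove (p ∷ pre) post (there y∈) y≢x = there (∈-remove pre post y∈ y≢x)

Unique-⊆⇒length≤ : ∀ {A : Set} {xs ys : List A} → Unique xs → xs ⊆ ys → length xs ≤ length ys
Unique-⊆⇒length≤ {xs = []} _ _ = z≤n
Unique-⊆⇒length≤ {xs = x ∷ xs} (x∉xs ∷ u) xs⊆ys with pre , post , refl ← ∈-∃++ (xs⊆ys (here refl)) =
  subst (suc (length xs) ≤_) (sym (↭-length (shift x pre post))) (s≤s (Unique-⊆⇒length≤ u xs⊆pre++post))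
  where
  xs⊆pre++post : xs ⊆ pre ++ post
  xs⊆pre++post y∈xs = ∈-remove pre post (xs⊆ys (there y∈xs)) (λ y≡x → lookup x∉xs y∈xs (sym y≡x))

Unique⇒length≤count : ∀ {n} (p : Fin n → Bool) {xs} → Unique xs → All (λ x → p x ≡ true) xs →
                      length xs ≤ count p
Unique⇒length≤count p {xs} u all-p = subst (length xs ≤_) (length-filterᵇ-tabulate p id)
  (Unique-⊆⇒length≤ u λ x∈xs → ∈-filter⁺ (T? ∘ p) (∈-allFin _) (subst Data.Bool.T (sym (lookup all-p x∈xs)) tt))

Unique⇒length≤ : ∀ {n} {xs : List (Fin n)} → Unique xs → length xs ≤ n
Unique⇒length≤ {n} {xs} u = subst (length xs ≤_) (length-tabulate id) (Unique-⊆⇒length≤ u (λ _ → ∈-allFin _))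

last-∷ : ∀ {A : Set} (x : A) xs → ∃ λ z → last (x ∷ xs) ≡ just z × z ∈ x ∷ xs
last-∷ x [] = x , refl , here refl
last-∷ x (y ∷ ys) with z , e , z∈ ← last-∷ y ys = z , e , there z∈

last-∷ʳ : ∀ {A : Set} (xs : List A) a → last (xs ++ [ a ]) ≡ just a
last-∷ʳ [] a = refl
last-∷ʳ (x ∷ []) a = refl
last-∷ʳ (x ∷ y ∷ xs) a = last-∷ʳ (y ∷ xs) a

Unique-++⁻ˡ : ∀ {A : Set} (xs : List A) {ys} → Unique (xs ++ ys) → Unique xs
Unique-++⁻ˡ [] u = []
Unique-++⁻ˡ (x ∷ xs) (x∉ ∷ u) = All.++⁻ˡ xs x∉ ∷ Unique-++⁻ˡ xs u

Linked-++⁻ˡ : ∀ {A : Set} {R : A → A → Set} (xs : List A) {ys} → Linked R (xs ++ ys) → Linked R xs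
Linked-++⁻ˡ [] l = []
Linked-++⁻ˡ (x ∷ []) l = [-]
Linked-++⁻ˡ (x ∷ y ∷ xs) (r ∷ l) = r ∷ Linked-++⁻ˡ (y ∷ xs) l

module _ {n : ℕ} (G : Graph n) where

  Reach-trans : ∀ {i j k} → Reach G i j → Reach G j k → Reach G i k
  Reach-trans here r = r
  Reach-trans (step a r) r′ = step a (Reach-trans r r′)

  Adj-sym : ∀ {i j} → Adj G i j → Adj G j i
  Adj-sym {i} {j} a = trans (Graph.sym G j i) a

  Reach-sym : ∀ {i j} → Reach G i j → Reach G j i
  Reach-sym here = here
  Reach-sym (step a r) = Reach-trans (Reach-sym r) (step (Adj-sym a) here)

  Adj-irrefl : ∀ {i j} → Adj G i j → i ≢ j
  Adj-irrefl {i} a refl with () ← trans (sym a) (irrefl G i)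

  deg≡count : ∀ i → deg G i ≡ count (adj G i)
  deg≡count i = length-filterᵇ-tabulate (adj G i) id

  Adj⇒deg≥1 : ∀ {i j} → Adj G i j → 1 ≤ deg G i
  Adj⇒deg≥1 {i} a = subst (1 ≤_) (sym (deg≡count i)) (count-positive (adj G i) a)

  AtMostOneNeighbour : Fin n → Set
  AtMostOneNeighbour x = ∀ {y z} → Adj G x y → Adj G x z → y ≡ z

  deg≡1⇒AtMostOneNeighbour : ∀ {x} → deg G x ≡ 1 → AtMostOneNeighbour x
  deg≡1⇒AtMostOneNeighbour {x} d = count≡1⇒unique (adj G x) (trans (sym (deg≡count x)) d)

  another-neighbour : ∀ {x y} → Adj G x y → deg G x ≢ 1 → ∃ λ z → z ≢ y × Adj G x z
  another-neighbour {x} xy d≢1 = count≥2⇒another (adj G x)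
    (subst (2 ≤_) (deg≡count x) (≤∧≢⇒< (Adj⇒deg≥1 xy) (d≢1 ∘ sym))) xy

  IsCycle-rotate : ∀ a as → IsCycle G (a ∷ as) → IsCycle G (as ++ [ a ])
  IsCycle-rotate a [] (s≤s () , _)
  IsCycle-rotate a (b ∷ bs) (len , (a∉ ∷ u) , (ab ∷ l) , closing)
    with z , last≡z , _ ← last-∷ b bs =
      subst (3 ≤_) (sym (trans (length-++ (b ∷ bs)) (+-comm _ 1))) len
    , Unique.++⁺ u ([] ∷ []) (λ { (v∈ , here refl) → lookup a∉ v∈ refl })
    , Linked.++⁺ l (subst (λ m → Maybe.Connected (Adj G) m (just a)) (sym last≡z)
                          (Maybe.just (closing a z refl last≡z))) [-]
    , λ { _ y refl last≡y → subst (λ y → Adj G y b) (just-injective (trans (sym (last-∷ʳ (b ∷ bs) a)) last≡y)) ab }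

  IsCycle-rotate-to : ∀ {x} pre post → IsCycle G (pre ++ x ∷ post) → ∃ λ rest → IsCycle G (x ∷ rest)
  IsCycle-rotate-to [] post c = post , c
  IsCycle-rotate-to {x} (p ∷ pre) post c =
    IsCycle-rotate-to pre (post ++ [ p ])
      (subst (IsCycle G) (++-assoc pre (x ∷ post) [ p ]) (IsCycle-rotate p (pre ++ x ∷ post) c))

  -- The two cycle-neighbours of x, its successor and the last vertex, coincide.
  ¬IsCycle-from : ∀ {x} → AtMostOneNeighbour x → ∀ rest → ¬ IsCycle G (x ∷ rest)
  ¬IsCycle-from x≤1 [] (s≤s () , _)
  ¬IsCycle-from x≤1 (y ∷ []) (s≤s (s≤s ()) , _)
  ¬IsCycle-from x≤1 (y ∷ w ∷ r) (len , (_ ∷ (y∉ ∷ _)) , (xy ∷ _) , closing)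
    with z , last≡z , z∈ ← last-∷ w r =
      lookup y∉ z∈ (x≤1 xy (Adj-sym (closing _ z refl last≡z)))

  ¬IsCycle-through : ∀ {x vs} → AtMostOneNeighbour x → x ∈ vs → ¬ IsCycle G vs
  ¬IsCycle-through x≤1 x∈ c with pre , post , refl ← ∈-∃++ x∈ with rest , c′ ← IsCycle-rotate-to pre post c =
    ¬IsCycle-from x≤1 rest c′

module _ {a b : ℕ} {G : Graph a} {H : Graph b} (f : Fin a → Fin b) where

  IsCycle-map⁺ : (∀ {i j} → f i ≡ f j → i ≡ j) → (∀ {i j} → Adj G i j → Adj H (f i) (f j)) →
                 ∀ {ws} → IsCycle G ws → IsCycle H (map f ws)
  IsCycle-map⁺ inj hom {w ∷ ws} (len , u , l , closing) with z , last≡z , _ ← last-∷ w ws =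
      subst (3 ≤_) (sym (length-map f (w ∷ ws))) len
    , Unique.map⁺ inj u
    , Linked.map⁺ (Linked.map hom l)
    , λ { _ y refl last≡y → subst (λ y → Adj H y (f w))
            (just-injective (trans (sym (trans (last-map f (w ∷ ws)) (cong (Data.Maybe.map f) last≡z))) last≡y))
            (hom (closing w z refl last≡z)) }

  IsCycle-map⁻ : (∀ {i j} → Adj H (f i) (f j) → Adj G i j) → ∀ {ws} → IsCycle H (map f ws) → IsCycle G ws
  IsCycle-map⁻ hom {w ∷ ws} (len , u , l , closing) =
      subst (3 ≤_) (length-map f (w ∷ ws)) len
    , Unique.map⁻ u
    , Linked.map hom (Linked.map⁻ l)
    , λ { _ y refl last≡y →
          hom (closing (f w) (f y) refl (trans (last-map f (w ∷ ws)) (cong (Data.Maybe.map f) last≡y))) }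


-- Adding and removing leaves

does-≟⇒≡ : ∀ {n} {i j : Fin n} → does (i ≟ j) ≡ true → i ≡ j
does-≟⇒≡ {i = i} {j} e with i ≟ j | e
... | yes i≡j | _ = i≡j

tabulate-punchIn : ∀ {A : Set} {n} (f : Fin (suc n) → A) i → tabulate f ↭ f i ∷ tabulate (f ∘ punchIn i)
tabulate-punchIn f zero = ↭-refl
tabulate-punchIn {n = suc n} f (suc i) = ↭-trans (prep (f zero) (tabulate-punchIn (f ∘ suc) i)) (swap _ _ ↭-refl)

∉-map-suc : ∀ {n} (vs : List (Fin (suc n))) → zero ∉ vs → ∃ λ ws → vs ≡ map suc ws
∉-map-suc [] _ = [] , refl
∉-map-suc (zero ∷ vs) zero∉ = contradiction (here refl) zero∉
∉-map-suc (suc v ∷ vs) zero∉ with ws , refl ← ∉-map-suc vs (zero∉ ∘ there) = v ∷ ws , refl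

addLeaf : ∀ {n} → Graph n → Fin n → Graph (suc n)
addLeaf {n} G p = record { adj = A ; irrefl = A-irrefl ; sym = A-sym }
  where
  A : Fin (suc n) → Fin (suc n) → Bool
  A zero zero = false
  A zero (suc j) = does (j ≟ p)
  A (suc i) zero = does (i ≟ p)
  A (suc i) (suc j) = adj G i j
  A-irrefl : ∀ i → A i i ≡ false
  A-irrefl zero = refl
  A-irrefl (suc i) = irrefl G i
  A-sym : ∀ i j → A i j ≡ A j i
  A-sym zero zero = refl
  A-sym zero (suc j) = refl
  A-sym (suc i) zero = refl
  A-sym (suc i) (suc j) = Graph.sym G i j

module _ {n : ℕ} (G : Graph n) (p : Fin n) where

  private
    G⁺ = addLeaf G p

  Reach-addLeaf : ∀ {i j} → Reach G i j → Reach G⁺ (suc i) (suc j)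
  Reach-addLeaf here = here
  Reach-addLeaf (step a r) = step a (Reach-addLeaf r)

  addLeaf-Connected : Connected G → Connected G⁺
  addLeaf-Connected con i j = Reach-trans G⁺ (toNew i) (Reach-sym G⁺ (toNew j))
    where
    toNew : ∀ i → Reach G⁺ i zero
    toNew zero = here
    toNew (suc i) = Reach-trans G⁺ (Reach-addLeaf (con i p)) (step (dec-true (p ≟ p) refl) here)

  new-AtMostOneNeighbour : AtMostOneNeighbour G⁺ zero
  new-AtMostOneNeighbour {zero} ()
  new-AtMostOneNeighbour {suc y} {zero} _ ()
  new-AtMostOneNeighbour {suc y} {suc z} ay az = cong suc (trans (does-≟⇒≡ ay) (sym (does-≟⇒≡ az)))

  addLeaf-Acyclic : Acyclic G → Acyclic G⁺
  addLeaf-Acyclic acy vs c with any? (zero ≟_) vs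
  ... | yes zero∈ = ¬IsCycle-through G⁺ new-AtMostOneNeighbour zero∈ c
  ... | no zero∉ with ws , refl ← ∉-map-suc vs zero∉ = acy ws (IsCycle-map⁻ {G = G} {H = G⁺} suc id c)

  addLeaf-IsTree : IsTree G → IsTree G⁺
  addLeaf-IsTree (_ , con , acy) = s≤s z≤n , addLeaf-Connected con , addLeaf-Acyclic acy

  deg-addLeaf-new : deg G⁺ zero ≡ 1
  deg-addLeaf-new = trans (deg≡count G⁺ zero) (count-point p)

  deg-addLeaf-old : ∀ i → deg G⁺ (suc i) ≡ indicator (does (i ≟ p)) + deg G i
  deg-addLeaf-old i = trans (deg≡count G⁺ (suc i)) (cong (indicator (does (i ≟ p)) +_) (sym (deg≡count G i)))

addLeaf-degrees : ∀ {n} (G : Graph n) p {rest} → tabulate (deg G) ↭ deg G p ∷ rest →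
                  tabulate (deg (addLeaf G p)) ↭ 1 ∷ suc (deg G p) ∷ rest
addLeaf-degrees {suc m} G p {rest} degs = begin
  deg G⁺ zero ∷ tabulate (deg G⁺ ∘ suc)                    ≡⟨ cong (_∷ tabulate (deg G⁺ ∘ suc)) (deg-addLeaf-new G p) ⟩
  1 ∷ tabulate (deg G⁺ ∘ suc)                              ↭⟨ prep 1 (tabulate-punchIn (deg G⁺ ∘ suc) p) ⟩
  1 ∷ deg G⁺ (suc p) ∷ tabulate (deg G⁺ ∘ suc ∘ punchIn p)  ≡⟨ cong₂ (λ d ds → 1 ∷ d ∷ ds) at-p elsewhere ⟩
  1 ∷ suc (deg G p) ∷ tabulate (deg G ∘ punchIn p)         ↭⟨ prep 1 (prep _ others) ⟩
  1 ∷ suc (deg G p) ∷ rest                                 ∎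
  where
  open PermutationReasoning
  G⁺ = addLeaf G p
  at-p : deg G⁺ (suc p) ≡ suc (deg G p)
  at-p = trans (deg-addLeaf-old G p p) (cong (λ b → indicator b + deg G p) (dec-true (p ≟ p) refl))
  others : tabulate (deg G ∘ punchIn p) ↭ rest
  others = drop-∷ (↭-trans (↭-sym (tabulate-punchIn (deg G) p)) degs)
  elsewhere : tabulate (deg G⁺ ∘ suc ∘ punchIn p) ≡ tabulate (deg G ∘ punchIn p)
  elsewhere = tabulate-cong λ i → trans (deg-addLeaf-old G p (punchIn p i))
    (cong (λ b → indicator b + deg G (punchIn p i)) (dec-false (punchIn p i ≟ p) (punchInᵢ≢i p i)))

addPendantEdge : ∀ {n} → Graph n → Fin n → Graph (2 + n)
addPendantEdge G p = addLeaf (addLeaf G p) zero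

addPendantEdge-IsTree : ∀ {n} (G : Graph n) p → IsTree G → IsTree (addPendantEdge G p)
addPendantEdge-IsTree G p = addLeaf-IsTree (addLeaf G p) zero ∘ addLeaf-IsTree G p

addPendantEdge-degrees : ∀ {n} (G : Graph n) p {rest} → tabulate (deg G) ↭ deg G p ∷ rest →
                         tabulate (deg (addPendantEdge G p)) ↭ 1 ∷ 2 ∷ suc (deg G p) ∷ rest
addPendantEdge-degrees G p {rest} degs = begin
  tabulate (deg (addLeaf G⁺ zero))                ↭⟨ addLeaf-degrees G⁺ zero ↭-refl ⟩
  1 ∷ suc (deg G⁺ zero) ∷ tabulate (deg G⁺ ∘ suc)  ≡⟨ cong (λ d → 1 ∷ suc d ∷ tabulate (deg G⁺ ∘ suc)) new ⟩
  1 ∷ 2 ∷ tabulate (deg G⁺ ∘ suc)                 ↭⟨ prep 1 (prep 2 rest⁺) ⟩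
  1 ∷ 2 ∷ suc (deg G p) ∷ rest                    ∎
  where
  open PermutationReasoning
  G⁺ = addLeaf G p
  new = deg-addLeaf-new G p
  rest⁺ : tabulate (deg G⁺ ∘ suc) ↭ suc (deg G p) ∷ rest
  rest⁺ = drop-∷ (subst (λ d → d ∷ tabulate (deg G⁺ ∘ suc) ↭ 1 ∷ suc (deg G p) ∷ rest) new
                        (addLeaf-degrees G p degs))

removeVertex : ∀ {n} → Graph (suc n) → Fin (suc n) → Graph n
removeVertex G ℓ = record
  { adj = λ i j → adj G (punchIn ℓ i) (punchIn ℓ j)
  ; irrefl = λ i → irrefl G (punchIn ℓ i)
  ; sym = λ i j → Graph.sym G (punchIn ℓ i) (punchIn ℓ j)
  }

module _ {n : ℕ} (G : Graph (suc n)) {ℓ : Fin (suc n)} (leaf : deg G ℓ ≡ 1) where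

  private
    G⁻ = removeVertex G ℓ

  -- A walk entering the leaf ℓ must leave it back to the vertex it came from; cut out that detour.
  Reach-removeLeaf : ∀ {a b} → Reach G a b → ∀ {i j} → a ≡ punchIn ℓ i → b ≡ punchIn ℓ j → Reach G⁻ i j
  Reach-removeLeaf here a≡ b≡ = subst (Reach G⁻ _) (punchIn-injective ℓ _ _ (trans (sym a≡) b≡)) here
  Reach-removeLeaf (step {k = k} ak r) {i} refl b≡ with ℓ ≟ k
  ... | no ℓ≢k = step (subst (Adj G (punchIn ℓ i)) (sym (punchIn-punchOut ℓ≢k)) ak)
                      (Reach-removeLeaf r (sym (punchIn-punchOut ℓ≢k)) b≡)
  Reach-removeLeaf (step ak here) {j = j} refl b≡ | yes refl = contradiction (sym b≡) (punchInᵢ≢i ℓ j)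
  Reach-removeLeaf (step ak (step ak₂ r)) refl b≡ | yes refl =
    Reach-removeLeaf r (deg≡1⇒AtMostOneNeighbour G leaf ak₂ (Adj-sym G ak)) b≡

  removeLeaf-IsTree : IsTree G → 1 ≤ n → IsTree G⁻
  removeLeaf-IsTree (_ , con , acy) 1≤n =
      1≤n
    , (λ i j → Reach-removeLeaf (con _ _) refl refl)
    , (λ ws c → acy _ (IsCycle-map⁺ {G = G⁻} {H = G} (punchIn ℓ) (punchIn-injective ℓ _ _) id c))

  ∑deg-removeLeaf : ∑ (deg G) ≡ 2 + ∑ (deg G⁻)
  ∑deg-removeLeaf = begin
    ∑ (deg G)                                                          ≡⟨ sum-remove {i = ℓ} (deg G) ⟩
    deg G ℓ + ∑ (deg G ∘ punchIn ℓ)                                    ≡⟨ cong₂ _+_ leaf (sum-cong-≗ split) ⟩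
    1 + ∑ (λ i → indicator (adj G ℓ (punchIn ℓ i)) + deg G⁻ i)          ≡⟨ cong suc (∑-distrib-+ _ (deg G⁻)) ⟩
    1 + (count (adj G ℓ ∘ punchIn ℓ) + ∑ (deg G⁻))                      ≡⟨ cong (λ c → suc (c + ∑ (deg G⁻))) to-ℓ ⟩
    2 + ∑ (deg G⁻)                                                     ∎
    where
    open ≡-Reasoning
    split : ∀ i → deg G (punchIn ℓ i) ≡ indicator (adj G ℓ (punchIn ℓ i)) + deg G⁻ i
    split i = begin
      deg G (punchIn ℓ i)                                 ≡⟨ deg≡count G (punchIn ℓ i) ⟩
      count (adj G (punchIn ℓ i))                         ≡⟨ count-remove (adj G (punchIn ℓ i)) ℓ ⟩
      indicator (adj G (punchIn ℓ i) ℓ) + count (adj G⁻ i) ≡⟨ cong₂ _+_ (cong indicator (Graph.sym G _ ℓ))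
                                                                          (sym (deg≡count G⁻ i)) ⟩
      indicator (adj G ℓ (punchIn ℓ i)) + deg G⁻ i         ∎
    to-ℓ : count (adj G ℓ ∘ punchIn ℓ) ≡ 1
    to-ℓ = begin
      count (adj G ℓ ∘ punchIn ℓ)                         ≡⟨ cong (λ b → indicator b + count (adj G ℓ ∘ punchIn ℓ))
                                                                   (sym (irrefl G ℓ)) ⟩
      indicator (adj G ℓ ℓ) + count (adj G ℓ ∘ punchIn ℓ) ≡⟨ sym (count-remove (adj G ℓ) ℓ) ⟩
      count (adj G ℓ)                                     ≡⟨ sym (deg≡count G ℓ) ⟩
      deg G ℓ                                             ≡⟨ leaf ⟩
      1                                                   ∎

-- Leaves and the degree sum of a tree

module _ {n : ℕ} (G : Graph n) (acy : Acyclic G) where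

  IsPath : List (Fin n) → Set
  IsPath vs = Unique vs × Linked (Adj G) vs

  -- The second neighbour z of x is off the path, for otherwise x ∷ y ∷ … ∷ z would be a cycle.
  extend-path : ∀ {x y rest} → IsPath (x ∷ y ∷ rest) → deg G x ≢ 1 → ∃ λ z → IsPath (z ∷ x ∷ y ∷ rest)
  extend-path {x} {y} {rest} (u , l@(xy ∷ _)) d≢1
    with z , z≢y , xz ← another-neighbour G xy d≢1
    with any? (z ≟_) rest
  ... | no z∉rest = z , (z∉ ∷ u) , (Adj-sym G xz ∷ l)
    where
    z∉ : All (z ≢_) (x ∷ y ∷ rest)
    z∉ = (λ z≡x → Adj-irrefl G xz (sym z≡x)) ∷ z≢y ∷ ¬Any⇒All¬ rest z∉rest
  ... | yes z∈rest with pre , post , refl ← ∈-∃++ z∈rest = contradiction cycle (acy (x ∷ y ∷ pre ++ [ z ]))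
    where
    path≡ : x ∷ y ∷ pre ++ z ∷ post ≡ (x ∷ y ∷ pre ++ [ z ]) ++ post
    path≡ = cong (λ r → x ∷ y ∷ r) (sym (++-assoc pre [ z ] post))
    cycle : IsCycle G (x ∷ y ∷ pre ++ [ z ])
    cycle = s≤s (s≤s (subst (1 ≤_) (sym (length-++ pre)) (m≤n+m 1 (length pre))))
          , Unique-++⁻ˡ (x ∷ y ∷ pre ++ [ z ]) (subst Unique path≡ u)
          , Linked-++⁻ˡ (x ∷ y ∷ pre ++ [ z ]) (subst (Linked (Adj G)) path≡ l)
          , λ { _ b refl last≡b → subst (λ b → Adj G b x)
                  (just-injective (trans (sym (last-∷ʳ (x ∷ y ∷ pre) z)) last≡b)) (Adj-sym G xz) }

  -- Paths cannot be longer than n, so extending a path from a non-leaf end must stop at a leaf.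
  path⇒leaf : ∀ fuel {x y rest} → IsPath (x ∷ y ∷ rest) → n < length (x ∷ y ∷ rest) + fuel →
              ∃ λ ℓ → deg G ℓ ≡ 1
  path⇒leaf zero (u , _) n< = contradiction (Unique⇒length≤ u) (<⇒≱ (subst (n <_) (+-identityʳ _) n<))
  path⇒leaf (suc fuel) {x} p n< with deg G x ≟ℕ 1
  ... | yes d≡1 = x , d≡1
  ... | no d≢1 with z , p′ ← extend-path p d≢1 = path⇒leaf fuel p′ (subst (n <_) (+-suc _ fuel) n<)

leaf-exists : ∀ {m} (G : Graph (suc (suc m))) → IsTree G → ∃ λ ℓ → deg G ℓ ≡ 1
leaf-exists {m} G (_ , con , acy) with con zero (suc zero)
... | step a _ = path⇒leaf G acy (suc (suc m)) ((Adj-irrefl G (Adj-sym G a) ∷ []) ∷ [] ∷ [] , Adj-sym G a ∷ [-])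
                         (s≤s (m≤n+m _ 1))

∑deg-tree : ∀ n (G : Graph n) → IsTree G → ∑ (deg G) + 2 ≡ 2 * n
∑deg-tree (suc zero) G _ =
  trans (cong (λ d → d + 0 + 2) (deg≡count G zero)) (cong (λ b → indicator b + 0 + 0 + 2) (irrefl G zero))
∑deg-tree zero G (() , _)
∑deg-tree (suc (suc m)) G tree = begin
  ∑ (deg G) + 2                        ≡⟨ cong (_+ 2) (∑deg-removeLeaf G leaf) ⟩
  2 + (∑ (deg (removeVertex G ℓ)) + 2)  ≡⟨ cong (2 +_) (∑deg-tree (suc m) (removeVertex G ℓ) tree⁻) ⟩
  2 + 2 * suc m                         ≡⟨ sym (*-distribˡ-+ 2 1 (suc m)) ⟩
  2 * suc (suc m)                       ∎
  where
  open ≡-Reasoning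
  ℓ = proj₁ (leaf-exists G tree)
  leaf = proj₂ (leaf-exists G tree)
  tree⁻ = removeLeaf-IsTree G leaf tree (s≤s z≤n)

Reach⇒deg≥1 : ∀ {n} (G : Graph n) {i j} → Reach G i j → i ≢ j → 1 ≤ deg G i
Reach⇒deg≥1 G here i≢i = contradiction refl i≢i
Reach⇒deg≥1 G (step a _) _ = Adj⇒deg≥1 G a

IsTree⇒deg≥1 : ∀ {n} (G : Graph n) → IsTree G → 2 ≤ n → ∀ i → 1 ≤ deg G i
IsTree⇒deg≥1 G (_ , con , _) (s≤s (s≤s _)) i =
  Reach⇒deg≥1 G (con i (punchIn i zero)) (λ i≡ → punchInᵢ≢i i zero (sym i≡))

-- Matchings

ends : ∀ {A : Set} → List (A × A) → List A
ends = concatMap (λ e → proj₁ e ∷ proj₂ e ∷ [])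

length-ends : ∀ {A : Set} (M : List (A × A)) → length (ends M) ≡ 2 * length M
length-ends [] = refl
length-ends (e ∷ M) = trans (cong (2 +_) (length-ends M)) (sym (*-suc 2 (length M)))

module _ {A : Set} (choose : A × A → A) (choose-end : ∀ e → choose e ≡ proj₁ e ⊎ choose e ≡ proj₂ e) where

  choose-∈-ends : ∀ {e M} → e ∈ M → choose e ∈ ends M
  choose-∈-ends {e} (here refl) with choose-end e
  ... | inj₁ c≡a = here c≡a
  ... | inj₂ c≡b = there (here c≡b)
  choose-∈-ends (there e∈) = there (there (choose-∈-ends e∈))

  Unique-map-choose : ∀ M → Unique (ends M) → Unique (map choose M)
  Unique-map-choose [] _ = []
  Unique-map-choose (e ∷ M) ((_ ∷ a∉) ∷ b∉ ∷ u) =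
    All.map⁺ (All.tabulate (λ e′∈ → lookup chosen∉ (choose-∈-ends e′∈))) ∷ Unique-map-choose M u
    where
    chosen∉ : All (choose e ≢_) (ends M)
    chosen∉ with choose-end e
    ... | inj₁ c≡a = subst (λ c → All (c ≢_) (ends M)) (sym c≡a) a∉
    ... | inj₂ c≡b = subst (λ c → All (c ≢_) (ends M)) (sym c≡b) b∉

module _ {n : ℕ} (G : Graph n) where

  IsMatching-drop : ∀ k {M} → IsMatching G M → IsMatching G (drop k M)
  IsMatching-drop zero m = m
  IsMatching-drop (suc k) {[]} m = m
  IsMatching-drop (suc k) {e ∷ M} (adj-M , (_ ∷ _ ∷ u)) = IsMatching-drop k ((adj-M ∘ there) , u)

  matching-of-size : ∀ {M} → IsMatching G M → ∀ {t} → t ≤ length M →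
                     ∃ λ M′ → IsMatching G M′ × length M′ ≡ t
  matching-of-size {M} m {t} t≤ =
    drop (length M ∸ t) M , IsMatching-drop (length M ∸ t) m ,
    trans (length-drop (length M ∸ t) M) (m∸[m∸n]≡n t≤)

  IsMatching-∷ : ∀ {M a b} → IsMatching G M → Adj G a b → a ∉ ends M → b ∉ ends M → IsMatching G ((a , b) ∷ M)
  IsMatching-∷ (adj-M , u) ab a∉ b∉ =
      (λ { (here refl) → ab ; (there e∈) → adj-M e∈ })
    , ((Adj-irrefl G ab ∷ ¬Any⇒All¬ _ a∉) ∷ (¬Any⇒All¬ _ b∉ ∷ u))

liftEdge : ∀ {n} → Fin n × Fin n → Fin (suc n) × Fin (suc n)
liftEdge = Product.map suc suc

ends-map-liftEdge : ∀ {n} (M : List (Fin n × Fin n)) → ends (map liftEdge M) ≡ map suc (ends M)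
ends-map-liftEdge [] = refl
ends-map-liftEdge (e ∷ M) = cong (λ es → suc (proj₁ e) ∷ suc (proj₂ e) ∷ es) (ends-map-liftEdge M)

IsMatching-addLeaf : ∀ {n} (G : Graph n) p {M} → IsMatching G M → IsMatching (addLeaf G p) (map liftEdge M)
IsMatching-addLeaf G p {M} (adj-M , u) =
    (λ e∈ → case-∈ (∈-map⁻ liftEdge e∈))
  , subst Unique (sym (ends-map-liftEdge M)) (Unique.map⁺ Data.Fin.Properties.suc-injective u)
  where
  case-∈ : ∀ {e} → ∃ (λ e′ → e′ ∈ M × e ≡ liftEdge e′) → Adj (addLeaf G p) (proj₁ e) (proj₂ e)
  case-∈ (_ , e′∈ , refl) = adj-M e′∈

IsMatching-addPendantEdge : ∀ {n} (G : Graph n) p {M} → IsMatching G M →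
  IsMatching (addPendantEdge G p) ((zero , suc zero) ∷ map liftEdge (map liftEdge M))
IsMatching-addPendantEdge G p {M} m =
  IsMatching-∷ (addPendantEdge G p) (IsMatching-addLeaf (addLeaf G p) zero (IsMatching-addLeaf G p m)) refl
    (subst (zero ∉_) (sym ends≡) (zero∉map-suc _))
    (subst (suc zero ∉_) (sym ends≡) (zero∉map-suc _ ∘ ∈-map⁻-suc))
  where
  ends≡ : ends (map liftEdge (map liftEdge M)) ≡ map suc (map suc (ends M))
  ends≡ = trans (ends-map-liftEdge (map liftEdge M)) (cong (map suc) (ends-map-liftEdge M))
  zero∉map-suc : ∀ {m} (xs : List (Fin m)) → Fin.zero ∉ map Fin.suc xs
  zero∉map-suc xs z∈ with _ , _ , () ← ∈-map⁻ Fin.suc z∈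
  ∈-map⁻-suc : ∀ {m} {x : Fin m} {xs} → Fin.suc x ∈ map Fin.suc xs → x ∈ xs
  ∈-map⁻-suc x∈ with _ , y∈ , refl ← ∈-map⁻ Fin.suc x∈ = y∈

*2≤⇒≤/2 : ∀ {l m} → l * 2 ≤ m → l ≤ m / 2
*2≤⇒≤/2 {l} {m} l*2≤m = subst (_≤ m / 2) (m*n/n≡m l 2) (/-monoˡ-≤ 2 l*2≤m)

third-vertex : ∀ {m} → 3 ≤ m → {a b : Fin m} → a ≢ b → ∃ λ c → c ≢ a × c ≢ b
third-vertex (s≤s (s≤s (s≤s _))) {a} {b} a≢b = punchIn a (punchIn b′ zero) , punchInᵢ≢i a _ , c≢b
  where
  b′ = punchOut a≢b
  c≢b : punchIn a (punchIn b′ zero) ≢ b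
  c≢b c≡b = punchInᵢ≢i b′ zero (punchIn-injective a _ _ (trans c≡b (sym (punchIn-punchOut a≢b))))

module _ {m : ℕ} (T : Graph m) where

  Reach-from-leaf-edge : ∀ {a b} → deg T a ≡ 1 → deg T b ≡ 1 → Adj T a b →
                         ∀ {x y} → Reach T x y → x ≡ a ⊎ x ≡ b → y ≡ a ⊎ y ≡ b
  Reach-from-leaf-edge leaf-a leaf-b ab here x∈ = x∈
  Reach-from-leaf-edge leaf-a leaf-b ab (step xk r) (inj₁ refl) =
    Reach-from-leaf-edge leaf-a leaf-b ab r (inj₂ (deg≡1⇒AtMostOneNeighbour T leaf-a xk ab))
  Reach-from-leaf-edge leaf-a leaf-b ab (step xk r) (inj₂ refl) =
    Reach-from-leaf-edge leaf-a leaf-b ab r (inj₁ (deg≡1⇒AtMostOneNeighbour T leaf-b xk (Adj-sym T ab)))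

  ¬leaf-edge : IsTree T → 3 ≤ m → ∀ {a b} → Adj T a b → deg T a ≡ 1 → deg T b ≡ 1 → ⊥
  ¬leaf-edge (_ , con , _) 3≤m {a} ab leaf-a leaf-b with c , c≢a , c≢b ← third-vertex 3≤m (Adj-irrefl T ab)
    with Reach-from-leaf-edge leaf-a leaf-b ab (con a c) (inj₁ refl)
  ... | inj₁ c≡a = c≢a c≡a
  ... | inj₂ c≡b = c≢b c≡b

  isLeaf : Fin m → Bool
  isLeaf i = deg T i ≡ᵇ 1

  isLeaf⇒deg≡1 : ∀ {i} → isLeaf i ≡ true → deg T i ≡ 1
  isLeaf⇒deg≡1 leaf = ≡ᵇ⇒≡ _ 1 (subst Data.Bool.T (sym leaf) tt)

  nonLeafEnd : Fin m × Fin m → Fin m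
  nonLeafEnd (a , b) = if isLeaf a then b else a

  nonLeafEnd-end : ∀ e → nonLeafEnd e ≡ proj₁ e ⊎ nonLeafEnd e ≡ proj₂ e
  nonLeafEnd-end (a , b) with isLeaf a
  ... | true = inj₂ refl
  ... | false = inj₁ refl

  nonLeafEnd-nonLeaf : IsTree T → 3 ≤ m → ∀ {a b} → Adj T a b → not (isLeaf (nonLeafEnd (a , b))) ≡ true
  nonLeafEnd-nonLeaf t 3≤m {a} {b} ab with isLeaf a in leaf-a
  ... | false = cong not leaf-a
  ... | true with isLeaf b in leaf-b
  ...   | false = refl
  ...   | true with () ← ¬leaf-edge t 3≤m ab (isLeaf⇒deg≡1 leaf-a) (isLeaf⇒deg≡1 leaf-b)

  matching≤half : ∀ {M} → IsMatching T M → length M ≤ m / 2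
  matching≤half {M} (_ , u) =
    *2≤⇒≤/2 (subst (_≤ m) (trans (length-ends M) (*-comm 2 (length M))) (Unique⇒length≤ u))

  matching≤nonLeaves : IsTree T → 3 ≤ m → ∀ {M} → IsMatching T M → length M ≤ count (not ∘ isLeaf)
  matching≤nonLeaves t 3≤m {M} (adj-M , u) = subst (_≤ count (not ∘ isLeaf)) (length-map nonLeafEnd M)
    (Unique⇒length≤count (not ∘ isLeaf) (Unique-map-choose nonLeafEnd nonLeafEnd-end M u)
                         (All.map⁺ (All.tabulate (λ e∈ → nonLeafEnd-nonLeaf t 3≤m (adj-M e∈)))))

  matching≤ : IsTree T → 3 ≤ m → ∀ {M} → IsMatching T M → length M ≤ (m / 2) ⊓ (m ∸ count isLeaf)
  matching≤ t 3≤m m = ⊓-glb (matching≤half m)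
    (subst (_ ≤_) (sym (trans (cong (_∸ count isLeaf) (sym (count-not isLeaf))) (m+n∸n≡m _ (count isLeaf))))
                  (matching≤nonLeaves t 3≤m m))

-- Trees with prescribed degrees and a large matching

-- ∑A + L = 2(|A| + L − 1) is the degree sum of a tree with non-leaf degrees A and L leaves.
Handshake : List ℕ → ℕ → Set
Handshake A L = sum A + 2 ≡ 2 * length A + L

Handshake-↭ : ∀ {A A′ L} → A ↭ A′ → Handshake A L → Handshake A′ L
Handshake-↭ {L = L} A↭A′ hs =
  trans (cong (_+ 2) (sym (sum-↭ A↭A′))) (trans hs (cong (λ l → 2 * l + L) (↭-length A↭A′)))

Handshake-pred : ∀ {a A L} → Handshake (suc a ∷ A) (suc L) → Handshake (a ∷ A) L
Handshake-pred {A = A} {L} hs = suc-injective (trans hs (+-suc (2 * suc (length A)) L))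

Handshake-drop-2 : ∀ {a A L} → Handshake (a ∷ 2 ∷ A) L → Handshake (a ∷ A) L
Handshake-drop-2 {a} {A} {L} hs = +-cancelˡ-≡ 2 _ _ (trans (lhs a (sum A)) (trans hs (rhs (length A) L)))
  where
  lhs : ∀ a s → 2 + (a + s + 2) ≡ a + (2 + s) + 2
  lhs = solve-∀
  rhs : ∀ l L → 2 * suc (suc l) + L ≡ 2 + (2 * suc l + L)
  rhs = solve-∀

Handshake-split : ∀ {A L} → sum (A ++ replicate L 1) + 2 ≡ 2 * length (A ++ replicate L 1) → Handshake A L
Handshake-split {A} {L} hs = +-cancelʳ-≡ L _ _ (begin
  sum A + 2 + L                   ≡⟨ regroup (sum A) L ⟩
  sum A + L + 2                   ≡⟨ cong (_+ 2) (sym sum≡) ⟩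
  sum (A ++ replicate L 1) + 2    ≡⟨ hs ⟩
  2 * length (A ++ replicate L 1) ≡⟨ cong (2 *_) len≡ ⟩
  2 * (length A + L)              ≡⟨ regroup′ (length A) L ⟩
  2 * length A + L + L            ∎)
  where
  sum-replicate-1 : ∀ L → sum (replicate L 1) ≡ L
  sum-replicate-1 zero = refl
  sum-replicate-1 (suc L) = cong suc (sum-replicate-1 L)
  sum≡ : sum (A ++ replicate L 1) ≡ sum A + L
  sum≡ = trans (sum-++ A (replicate L 1)) (cong (sum A +_) (sum-replicate-1 L))
  len≡ : length (A ++ replicate L 1) ≡ length A + L
  len≡ = trans (length-++ A) (cong (length A +_) (length-replicate L))
  regroup : ∀ s L → s + 2 + L ≡ s + L + 2
  regroup = solve-∀
  regroup′ : ∀ k L → 2 * (k + L) ≡ 2 * k + L + L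
  regroup′ = solve-∀
  open ≡-Reasoning

*length≤sum : ∀ {c A} → All (c ≤_) A → c * length A ≤ sum A
*length≤sum {c} [] = ≤-reflexive (*-zeroʳ c)
*length≤sum {c} {a ∷ A} (c≤a ∷ c≤A) =
  subst (_≤ a + sum A) (sym (*-suc c (length A))) (+-mono-≤ c≤a (*length≤sum c≤A))

sum≡*length : ∀ {c A} → All (_≡ c) A → sum A ≡ c * length A
sum≡*length {c} [] = sym (*-zeroʳ c)
sum≡*length {c} {_ ∷ A} (refl ∷ A≡c) = trans (cong (c +_) (sum≡*length A≡c)) (sym (*-suc c (length A)))

Handshake⇒2≤leaves : ∀ {A L} → All (2 ≤_) A → Handshake A L → 2 ≤ L
Handshake⇒2≤leaves {A} {L} A≥2 hs =
  +-cancelˡ-≤ (2 * length A) 2 L (subst (2 * length A + 2 ≤_) hs (+-monoˡ-≤ 2 (*length≤sum A≥2)))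

Handshake⇒internal+2≤leaves : ∀ {A L} → All (3 ≤_) A → Handshake A L → length A + 2 ≤ L
Handshake⇒internal+2≤leaves {A} {L} A≥3 hs = +-cancelˡ-≤ (2 * length A) (length A + 2) L
  (subst₂ _≤_ (regroup (length A)) hs (+-monoˡ-≤ 2 (*length≤sum A≥3)))
  where
  regroup : ∀ l → 3 * l + 2 ≡ 2 * l + (l + 2)
  regroup = solve-∀

Handshake-path⇒2-leaves : ∀ {A L} → All (_≡ 2) A → Handshake A L → L ≡ 2
Handshake-path⇒2-leaves {A} {L} A≡2 hs =
  sym (+-cancelˡ-≡ (2 * length A) 2 L (trans (cong (_+ 2) (sym (sum≡*length A≡2))) hs))

-- Large n k s says that s ≥ min k ⌊n/2⌋, stated without division.
Large : ℕ → ℕ → ℕ → Set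
Large n k s = k ≤ s ⊎ n ≤ suc (2 * s)

2+≤suc-2* : ∀ {n s} → n ≤ suc (2 * s) → 2 + n ≤ suc (2 * suc s)
2+≤suc-2* {n} {s} n≤ = subst (λ t → 2 + n ≤ suc t) (sym (*-suc 2 s)) (s≤s (s≤s n≤))

Large-pendant : ∀ {n k s} → Large n k s → Large (2 + n) (suc k) (suc s)
Large-pendant (inj₁ k≤s) = inj₁ (s≤s k≤s)
Large-pendant (inj₂ n≤) = inj₂ (2+≤suc-2* n≤)

Large-leaf : ∀ {n k s} → 2 * k < n → Large n k s → Large (suc n) k s
Large-leaf 2k<n (inj₁ k≤s) = inj₁ k≤s
Large-leaf 2k<n (inj₂ n≤) = inj₁ (*-cancelˡ-≤ 2 (s≤s⁻¹ (≤-trans 2k<n n≤)))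

-- On a path with l internal vertices, s ≥ l already forces s ≥ ⌊(l + 2)/2⌋.
Large-path : ∀ {n l s} → n ≡ l + 2 → 1 ≤ l → Large n l s → Large (2 + n) (2 + l) (suc s)
Large-path {l = l} {s} refl 1≤l (inj₁ l≤s) = inj₂ (2+≤suc-2* (begin
  l + 2           ≡⟨ +-comm l 2 ⟩
  suc (1 + l)     ≤⟨ s≤s (+-monoˡ-≤ l 1≤l) ⟩
  suc (l + l)     ≤⟨ s≤s (+-mono-≤ l≤s (≤-trans l≤s (m≤m+n s 0))) ⟩
  suc (2 * s)     ∎))
  where open ≤-Reasoning
Large-path refl 1≤l (inj₂ n≤) = inj₂ (2+≤suc-2* n≤)

Large⇒target≤ : ∀ {n k s} → Large n k s → (n / 2) ⊓ k ≤ s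
Large⇒target≤ {n} {k} (inj₁ k≤s) = ≤-trans (m⊓n≤n (n / 2) k) k≤s
Large⇒target≤ {n} {k} {s} (inj₂ n≤) =
  ≤-trans (m⊓n≤m (n / 2) k) (s≤s⁻¹ (m<n*o⇒m/o<n {n} {suc s} {2} (subst (n <_) (double s) (s≤s n≤))))
  where
  double : ∀ s → suc (suc (2 * s)) ≡ suc s * 2
  double = solve-∀

record Realisation (n : ℕ) (D : List ℕ) (k : ℕ) : Set where
  constructor realisation
  field
    tree : Graph n
    isTree : IsTree tree
    degrees : tabulate (deg tree) ↭ D
    matching : List (Fin n × Fin n)
    isMatching : IsMatching tree matching
    large : Large n k (length matching)

reorder : ∀ {n D D′ k} → Realisation n D k → D ↭ D′ → Realisation n D′ k
reorder (realisation T t degs M m large) D↭D′ = realisation T t (↭-trans degs D↭D′) M m large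

vertex-of-degree : ∀ {m} (f : Fin m → ℕ) {a rest} → tabulate f ↭ a ∷ rest →
                   ∃ λ v → f v ≡ a × tabulate f ↭ f v ∷ rest
vertex-of-degree f {a} {rest} f↭ with v , a≡ ← ∈-tabulate⁻ (∈-resp-↭ (↭-sym f↭) (here refl)) =
  v , sym a≡ , subst (λ b → tabulate f ↭ b ∷ rest) a≡ f↭

graftLeaf : ∀ {n a D k k′} → Realisation n (a ∷ D) k → (∀ {s} → Large n k s → Large (suc n) k′ s) →
            Realisation (suc n) (1 ∷ suc a ∷ D) k′
graftLeaf (realisation T t degs M m large) transfer with v , refl , degs-v ← vertex-of-degree (deg T) degs =
  realisation (addLeaf T v) (addLeaf-IsTree T v t) (addLeaf-degrees T v degs-v)
              (map liftEdge M) (IsMatching-addLeaf T v m)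
              (subst (Large _ _) (sym (length-map liftEdge M)) (transfer large))

graftPendant : ∀ {n a D k k′} → Realisation n (a ∷ D) k → (∀ {s} → Large n k s → Large (2 + n) k′ (suc s)) →
               Realisation (2 + n) (1 ∷ 2 ∷ suc a ∷ D) k′
graftPendant (realisation T t degs M m large) transfer with v , refl , degs-v ← vertex-of-degree (deg T) degs =
  realisation (addPendantEdge T v) (addPendantEdge-IsTree T v t) (addPendantEdge-degrees T v degs-v)
              _ (IsMatching-addPendantEdge T v m)
              (subst (Large _ _) (sym (cong suc (trans (length-map liftEdge (map liftEdge M)) (length-map liftEdge M))))
                     (transfer large))

K₁ : Graph 1
K₁ = record { adj = λ _ _ → false ; irrefl = λ _ → refl ; sym = λ _ _ → refl }

K₁-IsTree : IsTree K₁
K₁-IsTree = s≤s z≤n , (λ { zero zero → here }) , λ { _ (3≤ , u , _) → case ≤-trans 3≤ (Unique⇒length≤ u) of λ { (s≤s ()) } }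

point : Realisation 1 (0 ∷ []) 0
point = realisation K₁ K₁-IsTree ↭-refl [] ((λ ()) , []) (inj₁ z≤n)

edge : Realisation 2 (1 ∷ 1 ∷ []) 1
edge = realisation (addLeaf K₁ zero) (addLeaf-IsTree K₁ zero K₁-IsTree) (addLeaf-degrees K₁ zero ↭-refl)
                   ((zero , suc zero) ∷ []) (IsMatching-∷ (addLeaf K₁ zero) ((λ ()) , []) refl (λ ()) (λ ()))
                   (inj₁ (s≤s z≤n))

path₃ : Realisation 3 (2 ∷ 1 ∷ 1 ∷ []) 1
path₃ = reorder (graftPendant point Large-pendant) (swap 1 2 ↭-refl)

path₄ : Realisation 4 (2 ∷ 2 ∷ 1 ∷ 1 ∷ []) 2
path₄ = reorder (graftPendant edge Large-pendant) (↭-trans (swap 1 2 ↭-refl) (prep 2 (swap 1 2 ↭-refl)))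

∈⇒↭ : ∀ {A : Set} {x : A} {xs} → x ∈ xs → ∃ λ rest → xs ↭ x ∷ rest
∈⇒↭ x∈ with pre , post , refl ← ∈-∃++ x∈ = pre ++ post , shift _ pre post

leaf-to-front : ∀ {A B} R → A ↭ B → 1 ∷ B ++ R ↭ A ++ 1 ∷ R
leaf-to-front R A↭B = ↭-sym (↭-trans (shift 1 _ R) (prep 1 (++⁺ʳ R A↭B)))

all≡2 : ∀ {A} → All (2 ≤_) A → ¬ Any (3 ≤_) A → All (_≡ 2) A
all≡2 {A} A≥2 ¬big =
  All.zipWith (λ (2≤a , a≱3) → ≤-antisym (s≤s⁻¹ (≰⇒> a≱3)) 2≤a) (A≥2 , ¬Any⇒All¬ A ¬big)

mutual
  realise : ∀ n {A L} → n ≡ length A + L → All (2 ≤_) A → Handshake A L → 1 ≤ length A →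
            Realisation n (A ++ replicate L 1) (length A)
  realise zero {_ ∷ _} () _ _ _
  realise (suc n) {A} {zero} _ A≥2 hs _ with () ← Handshake⇒2≤leaves A≥2 hs
  realise (suc n) {A} {suc L} n≡ A≥2 hs 1≤k with any? (3 ≤?_) A
  ... | no ¬big with refl ← Handshake-path⇒2-leaves (all≡2 A≥2 ¬big) hs =
    realise-path n n≡ (all≡2 A≥2 ¬big) 1≤k
  ... | yes big with _ , a∈ , s≤s 2≤a ← find big with A₁ , A↭ ← ∈⇒↭ a∈ with any? (2 ≟ℕ_) A₁
  ...   | yes 2∈ with A₂ , A₁↭ ← ∈⇒↭ 2∈ = realise-pendant n n≡ (↭-trans A↭ (prep _ A₁↭)) 2≤a A≥2 hs
  ...   | no 2∉ = realise-leaf n n≡ A↭ 2≤a A₁≥3 hs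
    where
    A₁≥3 : All (3 ≤_) A₁
    A₁≥3 with _ ∷ A₁≥2 ← All-resp-↭ A↭ A≥2 =
      All.zipWith (λ (2≤b , 2≢b) → ≤∧≢⇒< 2≤b 2≢b) (A₁≥2 , ¬Any⇒All¬ A₁ 2∉)

  realise-leaf : ∀ n {A a A₁ L} → suc n ≡ length A + suc L → A ↭ suc a ∷ A₁ → 2 ≤ a → All (3 ≤_) A₁ →
                 Handshake A (suc L) → Realisation (suc n) (A ++ replicate (suc L) 1) (length A)
  realise-leaf n {A} {a} {A₁} {L} n≡ A↭ 2≤a A₁≥3 hs =
    reorder (graftLeaf (realise n n≡′ (2≤a ∷ All.map (≤-trans (s≤s (s≤s z≤n))) A₁≥3) (Handshake-pred {a} {A₁} hs′)
                                (s≤s z≤n))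
                       (subst (λ k → Large _ k _) (sym lenA) ∘ Large-leaf (subst (_ <_) (sym n≡′) 2k<n)))
            (leaf-to-front (replicate L 1) A↭)
    where
    lenA = ↭-length A↭
    hs′ = Handshake-↭ A↭ hs
    n≡′ : n ≡ suc (length A₁) + L
    n≡′ = suc-injective (trans n≡ (trans (cong (_+ suc L) lenA) (+-suc (suc (length A₁)) L)))
    2k<n : 2 * suc (length A₁) < suc (length A₁) + L
    2k<n = subst (_≤ suc (length A₁) + L) (regroup (length A₁))
      (+-monoʳ-≤ (suc (length A₁)) (s≤s⁻¹ (Handshake⇒internal+2≤leaves (s≤s 2≤a ∷ A₁≥3) hs′)))
      where
      regroup : ∀ l → suc l + (l + 2) ≡ suc (2 * suc l)
      regroup = solve-∀

  realise-pendant : ∀ n {A a A₂ L} → suc n ≡ length A + suc L → A ↭ suc a ∷ 2 ∷ A₂ → 2 ≤ a → All (2 ≤_) A →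
                    Handshake A (suc L) → Realisation (suc n) (A ++ replicate (suc L) 1) (length A)
  realise-pendant zero {A} {A₂ = A₂} {L} n≡ A↭ _ _ _ with () ← trans n≡ (cong (_+ suc L) (↭-length A↭))
  realise-pendant (suc n) {A} {a} {A₂} {L} n≡ A↭ 2≤a A≥2 hs =
    reorder (graftPendant (realise n n≡′ (2≤a ∷ A₂≥2) hs′ (s≤s z≤n))
                          (subst (λ k → Large _ k _) (sym lenA) ∘ Large-pendant))
            (leaf-to-front (replicate L 1) (↭-trans A↭ (swap _ _ ↭-refl)))
    where
    lenA = ↭-length A↭
    n≡′ : n ≡ suc (length A₂) + L
    n≡′ = suc-injective (suc-injective (trans n≡ (trans (cong (_+ suc L) lenA) (+-suc (2 + length A₂) L))))
    hs′ : Handshake (a ∷ A₂) L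
    hs′ = Handshake-pred {a} {A₂} (Handshake-drop-2 {suc a} {A₂} (Handshake-↭ A↭ hs))
    A₂≥2 : All (2 ≤_) A₂
    A₂≥2 with _ ∷ _ ∷ A₂≥2 ← All-resp-↭ A↭ A≥2 = A₂≥2

  realise-path : ∀ n {A} → suc n ≡ length A + 2 → All (_≡ 2) A → 1 ≤ length A →
                 Realisation (suc n) (A ++ replicate 2 1) (length A)
  realise-path n {2 ∷ []} refl (refl ∷ []) _ = path₃
  realise-path n {2 ∷ 2 ∷ []} refl (refl ∷ refl ∷ []) _ = path₄
  realise-path zero {2 ∷ 2 ∷ 2 ∷ A₃} () _ _
  realise-path (suc n) {2 ∷ 2 ∷ 2 ∷ A₃} n≡ (refl ∷ refl ∷ refl ∷ A₃≡2) _ =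
    reorder (graftPendant (reorder (realise n n≡′ (All.map (λ { refl → ≤-refl }) (refl ∷ A₃≡2)) hs′ (s≤s z≤n))
                                   (shift 1 (2 ∷ A₃) [ 1 ]))
                          (Large-path {l = length (2 ∷ A₃)} n≡′ (s≤s z≤n)))
            (leaf-to-front {2 ∷ 2 ∷ 2 ∷ A₃} [ 1 ] ↭-refl)
    where
    n≡′ : n ≡ length (2 ∷ A₃) + 2
    n≡′ = suc-injective (suc-injective n≡)
    hs′ : Handshake (2 ∷ A₃) 2
    hs′ = cong (_+ 2) (sum≡*length (refl ∷ A₃≡2))

internal : List ℕ → List ℕ
internal = filterᵇ (not ∘ (_≡ᵇ 1))

↭-internal++leaves : ∀ d → d ↭ internal d ++ replicate (n₁ d) 1
↭-internal++leaves [] = ↭-refl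
↭-internal++leaves (0 ∷ d) = prep 0 (↭-internal++leaves d)
↭-internal++leaves (1 ∷ d) = ↭-trans (prep 1 (↭-internal++leaves d)) (↭-sym (shift 1 (internal d) _))
↭-internal++leaves (suc (suc x) ∷ d) = prep _ (↭-internal++leaves d)

internal≥2 : ∀ {d} → All (1 ≤_) d → All (2 ≤_) (internal d)
internal≥2 [] = []
internal≥2 {1 ∷ d} (_ ∷ d≥1) = internal≥2 d≥1
internal≥2 {suc (suc x) ∷ d} (_ ∷ d≥1) = s≤s (s≤s z≤n) ∷ internal≥2 d≥1

module _ {d : List ℕ} {m : ℕ} {T : Graph m} (ds : DegSeq T d) where

  DegSeq⇒↭ : d ↭ tabulate (deg T)
  DegSeq⇒↭ = ↭-trans (proj₂ ds) (↭-reflexive (map-tabulate id (deg T)))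

  DegSeq⇒length≡ : length d ≡ m
  DegSeq⇒length≡ = trans (↭-length DegSeq⇒↭) (length-tabulate (deg T))

  DegSeq⇒n₁≡ : n₁ d ≡ count (isLeaf T)
  DegSeq⇒n₁≡ =
    trans (↭-length (filter-↭ (T? ∘ (_≡ᵇ 1)) DegSeq⇒↭)) (length-filterᵇ-tabulate (_≡ᵇ 1) (deg T))

  DegSeq⇒handshake : IsTree T → sum d + 2 ≡ 2 * length d
  DegSeq⇒handshake t = begin
    sum d + 2                 ≡⟨ cong (_+ 2) (trans (sum-↭ DegSeq⇒↭) (sum-tabulate (deg T))) ⟩
    ∑ (deg T) + 2             ≡⟨ ∑deg-tree m T t ⟩
    2 * m                     ≡⟨ cong (2 *_) (sym DegSeq⇒length≡) ⟩
    2 * length d              ∎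
    where open ≡-Reasoning

  DegSeq⇒positive : IsTree T → 2 ≤ length d → All (1 ≤_) d
  DegSeq⇒positive t 2≤ = All-resp-↭ (↭-sym DegSeq⇒↭)
    (All.tabulate⁺ (IsTree⇒deg≥1 T t (subst (2 ≤_) DegSeq⇒length≡ 2≤)))

  matching≤target : IsTree T → 3 ≤ length d → ∀ {M} → IsMatching T M →
                    length M ≤ (length d / 2) ⊓ (length d ∸ n₁ d)
  matching≤target t 3≤ {M} m rewrite DegSeq⇒length≡ | DegSeq⇒n₁≡ = matching≤ T t 3≤ m

internal-nonempty : ∀ {A L} → Handshake A L → 3 ≤ length A + L → 1 ≤ length A
internal-nonempty {[]} refl (s≤s (s≤s ()))
internal-nonempty {_ ∷ _} _ _ = s≤s z≤n

tree-with-large-matching : ∀ {d} → TreeDegSeq d → 3 ≤ length d →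
  Σ (Graph (length d)) λ T → IsTree T × DegSeq T d ×
    ∃ λ M → IsMatching T M × (length d / 2) ⊓ (length d ∸ n₁ d) ≤ length M
tree-with-large-matching {d} (_ , T₀ , t₀ , ds₀) 3≤n =
  tree R , isTree R , (proj₁ ds₀ , d↭) , matching R , isMatching R ,
  subst (λ k → (length d / 2) ⊓ k ≤ length (matching R)) k≡ (Large⇒target≤ (large R))
  where
  open Realisation
  split = ↭-internal++leaves d
  length≡ : length d ≡ length (internal d) + n₁ d
  length≡ = trans (↭-length split)
                  (trans (length-++ (internal d)) (cong (length (internal d) +_) (length-replicate (n₁ d))))
  hs : Handshake (internal d) (n₁ d)
  hs = Handshake-split {internal d} {n₁ d}
         (subst₂ (λ s l → s + 2 ≡ 2 * l) (sum-↭ split) (↭-length split) (DegSeq⇒handshake ds₀ t₀))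
  R = realise (length d) {internal d} {n₁ d} length≡
              (internal≥2 (DegSeq⇒positive ds₀ t₀ (≤-trans (s≤s (s≤s z≤n)) 3≤n))) hs
              (internal-nonempty {internal d} {n₁ d} hs (subst (3 ≤_) length≡ 3≤n))
  d↭ : d ↭ map (deg (tree R)) (allFin (length d))
  d↭ = ↭-trans split (↭-trans (↭-sym (degrees R)) (↭-reflexive (sym (map-tabulate id (deg (tree R))))))
  k≡ : length (internal d) ≡ length d ∸ n₁ d
  k≡ = sym (trans (cong (_∸ n₁ d) length≡) (m+n∸n≡m (length (internal d)) (n₁ d)))

lemma1 : (d : List ℕ) → TreeDegSeq d → 3 ≤ nOf d →
    ((Σ (Graph (nOf d)) λ T → IsTree T × DegSeq T d × MatchingNumber T ((nOf d / 2) ⊓ (nOf d ∸ n₁ d)))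
    × (∀ (m : ℕ) (T : Graph m) → IsTree T → DegSeq T d → ∀ k → MatchingNumber T k → k ≤ (nOf d / 2) ⊓ (nOf d ∸ n₁ d)))
lemma1 d tds 3≤n with T , t , ds , M , m , target≤ ← tree-with-large-matching tds 3≤n =
    (T , t , ds , matching-of-size T m target≤ , λ _ → matching≤target ds t 3≤n)
  , λ { _ T′ t′ ds′ _ ((_ , m′ , refl) , _) → matching≤target ds′ t′ 3≤n m′ }
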